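{- Let $P$ be a string of length $m$ and let $a,a'$ be integers with $0<a<a+a'<m$. If $P[1\!:\!m-a]\approx P[a+1\!:\!m]$ and $P[1\!:\!m-a']\approx P[a'+1\!:\!m]$, then $P[1\!:\!m-(a+a')]\approx P[(a+a')+1\!:\!m]$. Equivalently, for candidates $T_x,T_{x+a},T_{x+a+a'}$ in a text, if $T_x$ is consistent with $T_{x+a}$ and $T_{x+a}$ is consistent with $T_{x+a+a'}$, then $T_x$ is consistent with $T_{x+a+a'}$.
   Context: Strings are over integers; $S[i\!:\!j]$ denotes a substring. Strings $S,T$ of equal length $k$ are order-isomorphic, $S\approx T$, if $S[i]\le S[j]\iff T[i]\le T[j]$ for all $1\le i,j\le k$. For a text $T$ and pattern $P$ of length $m$, a candidate $T_x$ is the length-$m$ substring of $T$ starting at position $x$. Two overlapping candidates $T_x$ and $T_{x+a}$ ($0<a<m$) are consistent with respect to $P$ if $P[1\!:\!m-a]\approx P[a+1\!:\!m]$. -}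

module Defs where

open import Data.Nat using (ℕ; _+_; _∸_)
open import Data.Integer using (ℤ; _≤_)
open import Data.List using (List; length; take; drop; lookup)
open import Data.Fin using (Fin; cast)
open import Data.Product using (Σ; _×_)
open import Function.Bundles using (_⇔_)
open import Relation.Binary.PropositionalEquality using (_≡_)

Str : Set
Str = List ℤ

-- S[i : j], 1-indexed, both ends inclusive: the characters S[i], ..., S[j].
substr : Str → ℕ → ℕ → Str
substr S i j = take ((j + 1) ∸ i) (drop (i ∸ 1) S)

_≈ₒ_ : Str → Str → Set
S ≈ₒ T = Σ (length S ≡ length T) λ eq →
  (p q : Fin (length S)) →
    (lookup S p ≤ lookup S q) ⇔ (lookup T (cast eq p) ≤ lookup T (cast eq q))

-- Read P[1 : m-c] ≈ P[c+1 : m] as a statement about P alone: for all positions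
-- i, j < m - c, comparing P[i] with P[j] agrees with comparing P[i+c] with
-- P[j+c].  In this form consistency with shift a and with shift a' chains:
-- P[i] vs P[j] agrees with P[i+a] vs P[j+a] and hence with
-- P[i+a+a'] vs P[j+a+a'], and every index involved stays inside P.
module Submission where

open import Defs
open import Data.Nat as ℕ using (ℕ; zero; suc; _+_; _∸_; _<_; s≤s)
open import Data.Nat.Properties
  using (+-comm; +-suc; +-identityʳ; +-assoc; m+n∸n≡m; m∸n≤m; m≤n⇒m⊓n≡m; ∸-+-assoc; ≤-reflexive; ≤-trans)
open import Data.List using ([]; _∷_; length; take; drop; lookup)
open import Data.List.Properties using (length-take; length-drop; take-all)
open import Data.Integer using (ℤ; 0ℤ; _≤_)
open import Data.Fin using (Fin; toℕ; fromℕ<; cast)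
open import Data.Fin.Properties using (toℕ<n; toℕ-fromℕ<; toℕ-cast)
open import Data.Product using (_,_)
open import Function.Bundles using (_⇔_; mk⇔; Equivalence)
open import Function.Construct.Composition using (_⇔-∘_)
open import Function using (id)
open import Relation.Binary.PropositionalEquality

-- Total indexing; the value 0ℤ past the end is never inspected.
at : Str → ℕ → ℤ
at []       _       = 0ℤ
at (x ∷ xs) zero    = x
at (x ∷ xs) (suc i) = at xs i

lookup≡at : (S : Str) (p : Fin (length S)) → lookup S p ≡ at S (toℕ p)
lookup≡at (x ∷ S) Fin.zero    = refl
lookup≡at (x ∷ S) (Fin.suc p) = lookup≡at S p

at-take : ∀ k (S : Str) {i} → i < k → at (take k S) i ≡ at S i
at-take (suc k) []      _       = refl
at-take (suc k) (x ∷ S) {zero}  _       = refl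
at-take (suc k) (x ∷ S) {suc i} (s≤s h) = at-take k S h

at-drop : ∀ c (S : Str) i → at (drop c S) i ≡ at S (i + c)
at-drop zero    S       i       = cong (at S) (sym (+-identityʳ i))
at-drop (suc c) []      zero    = refl
at-drop (suc c) []      (suc i) = refl
at-drop (suc c) (x ∷ S) i       = trans (at-drop c S i) (cong (at (x ∷ S)) (sym (+-suc i c)))

m<o∸n⇒m+n<o : ∀ m {n o} → m < o ∸ n → m + n < o
m<o∸n⇒m+n<o m {zero}  h = subst (_< _) (sym (+-identityʳ m)) h
m<o∸n⇒m+n<o m {suc n} {suc o} h = subst (_< suc o) (sym (+-suc m n)) (s≤s (m<o∸n⇒m+n<o m h))

≤⇔≤-cong : ∀ {x y u v x′ y′ u′ v′ : ℤ} → x ≡ x′ → y ≡ y′ → u ≡ u′ → v ≡ v′ →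
           (x ≤ y ⇔ u ≤ v) → (x′ ≤ y′ ⇔ u′ ≤ v′)
≤⇔≤-cong refl refl refl refl e = e

SameOrder : ℕ → Str → Str → Set
SameOrder k S T = ∀ {i j} → i < k → j < k → (at S i ≤ at S j) ⇔ (at T i ≤ at T j)

≈ₒ⇒sameOrder : ∀ S T → S ≈ₒ T → SameOrder (length S) S T
≈ₒ⇒sameOrder S T (eq , iso) {i} {j} i<k j<k =
  ≤⇔≤-cong (atS i<k) (atS j<k) (atT i<k) (atT j<k) (iso (fromℕ< i<k) (fromℕ< j<k))
  where
  atS : ∀ {i} (i<k : i < length S) → lookup S (fromℕ< i<k) ≡ at S i
  atS i<k = trans (lookup≡at S _) (cong (at S) (toℕ-fromℕ< i<k))
  atT : ∀ {i} (i<k : i < length S) → lookup T (cast eq (fromℕ< i<k)) ≡ at T i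
  atT i<k = trans (lookup≡at T _) (cong (at T) (trans (toℕ-cast eq _) (toℕ-fromℕ< i<k)))

sameOrder⇒≈ₒ : ∀ S T → length S ≡ length T → SameOrder (length S) S T → S ≈ₒ T
sameOrder⇒≈ₒ S T eq same = eq , λ p q →
  ≤⇔≤-cong (sym (lookup≡at S p)) (sym (lookup≡at S q)) (sym (atT p)) (sym (atT q))
    (same (toℕ<n p) (toℕ<n q))
  where
  atT : ∀ p → lookup T (cast eq p) ≡ at T (toℕ p)
  atT p = trans (lookup≡at T _) (cong (at T) (toℕ-cast eq p))

-- P[1 : m-c] ≈ P[c+1 : m], with 0-based positions i standing for P[i+1].
Consistent : Str → ℕ → Set
Consistent P c = ∀ {i j} → i < length P ∸ c → j < length P ∸ c →
  (at P i ≤ at P j) ⇔ (at P (i + c) ≤ at P (j + c))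

prefix≡take : ∀ (P : Str) k → substr P 1 k ≡ take k P
prefix≡take P k = cong (λ n → take n P) (m+n∸n≡m k 1)

suffix≡drop : ∀ (P : Str) c → substr P (c + 1) (length P) ≡ drop c P
suffix≡drop P c = begin
  take (length P + 1 ∸ (c + 1)) (drop (c + 1 ∸ 1) P)
    ≡⟨ cong₂ (λ n d → take n (drop d P))
             (cong₂ _∸_ (+-comm (length P) 1) (+-comm c 1)) (m+n∸n≡m c 1) ⟩
  take (length P ∸ c) (drop c P)
    ≡⟨ take-all (length P ∸ c) (drop c P) (≤-reflexive (length-drop c P)) ⟩
  drop c P ∎
  where open ≡-Reasoning

length-prefix : ∀ (P : Str) c → length (take (length P ∸ c) P) ≡ length P ∸ c
length-prefix P c =
  trans (length-take (length P ∸ c) P) (m≤n⇒m⊓n≡m (m∸n≤m (length P) c))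

≈ₒ⇔consistent : ∀ (P : Str) c →
  substr P 1 (length P ∸ c) ≈ₒ substr P (c + 1) (length P) ⇔ Consistent P c
≈ₒ⇔consistent P c = mk⇔ to from
  where
  prefix suffix : Str
  prefix = take (length P ∸ c) P
  suffix = drop c P

  substr≡ : (substr P 1 (length P ∸ c) ≈ₒ substr P (c + 1) (length P)) ≡ (prefix ≈ₒ suffix)
  substr≡ = cong₂ _≈ₒ_ (prefix≡take P (length P ∸ c)) (suffix≡drop P c)

  bound : ∀ {i} → i < length P ∸ c → i < length prefix
  bound = subst (_ <_) (sym (length-prefix P c))

  unbound : ∀ {i} → i < length prefix → i < length P ∸ c
  unbound = subst (_ <_) (length-prefix P c)

  to : substr P 1 (length P ∸ c) ≈ₒ substr P (c + 1) (length P) → Consistent P c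
  to iso hi hj =
    ≤⇔≤-cong (at-take _ P hi) (at-take _ P hj) (at-drop c P _) (at-drop c P _)
      (≈ₒ⇒sameOrder prefix suffix (subst id substr≡ iso) (bound hi) (bound hj))

  from : Consistent P c → substr P 1 (length P ∸ c) ≈ₒ substr P (c + 1) (length P)
  from cons = subst id (sym substr≡) (sameOrder⇒≈ₒ prefix suffix
    (trans (length-prefix P c) (sym (length-drop c P)))
    λ hi hj → ≤⇔≤-cong (sym (at-take _ P (unbound hi))) (sym (at-take _ P (unbound hj)))
                        (sym (at-drop c P _)) (sym (at-drop c P _))
                        (cons (unbound hi) (unbound hj)))

consistent-+ : ∀ (P : Str) a a′ → Consistent P a → Consistent P a′ → Consistent P (a + a′)
consistent-+ P a a′ cons cons′ {i} {j} hi hj =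
  ≤⇔≤-cong refl refl (cong (at P) (+-assoc i a a′)) (cong (at P) (+-assoc j a a′))
    (cons′ (shifted hi) (shifted hj) ⇔-∘ cons (inPrefix hi) (inPrefix hj))
  where
  n = length P
  split : n ∸ (a + a′) ≡ n ∸ a′ ∸ a
  split = trans (cong (n ∸_) (+-comm a a′)) (sym (∸-+-assoc n a′ a))

  inPrefix : ∀ {k} → k < n ∸ (a + a′) → k < n ∸ a
  inPrefix h = ≤-trans h (subst (ℕ._≤ n ∸ a) (∸-+-assoc n a a′) (m∸n≤m (n ∸ a) a′))

  shifted : ∀ {k} → k < n ∸ (a + a′) → k + a < n ∸ a′
  shifted {k} h = m<o∸n⇒m+n<o k (subst (k <_) split h)

lemma5 : (P : Str) (a a' : ℕ) →
    0 < a → a < a + a' → a + a' < length P →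
    substr P 1 (length P ∸ a) ≈ₒ substr P (a + 1) (length P) →
    substr P 1 (length P ∸ a') ≈ₒ substr P (a' + 1) (length P) →
    substr P 1 (length P ∸ (a + a')) ≈ₒ substr P ((a + a') + 1) (length P)
lemma5 P a a' _ _ _ h h' =
  Equivalence.from (≈ₒ⇔consistent P (a + a'))
    (consistent-+ P a a' (Equivalence.to (≈ₒ⇔consistent P a) h)
                         (Equivalence.to (≈ₒ⇔consistent P a') h'))
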